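{- There exist absolute constants $\lambda>0$ and $c>0$ such that for every odd prime $q$ and every positive integer $M<\lambda q^{2/3}$, \[ \sum_{c_1=1}^{q}\sum_{c_2=1}^{q}\Delta(M,q,c_1,c_2)^2\geqslant c\,M^3. \]
   Context: For a prime $q$, a positive integer $M$ and integers $c_1,c_2$, let \[ A(M,q,c_1,c_2)=\big|\{(x,y,z)\in\{1,\dots,M\}^3: x^2-y^2\equiv c_1,\ y^2-z^2\equiv c_2 \ (\mathrm{mod}\ q)\}\big|, \] \[ A_0(q,c_1,c_2)=\big|\{(x,y,z)\in\{1,\dots,q\}^3: x^2-y^2\equiv c_1,\ y^2-z^2\equiv c_2 \ (\mathrm{mod}\ q)\}\big|, \] and $\Delta(M,q,c_1,c_2)=\big|A(M,q,c_1,c_2)-(M/q)^3A_0(q,c_1,c_2)\big|$. -}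

module Defs where

open import Data.Nat as ℕ using (ℕ; suc; NonZero)
import Data.Nat.Divisibility as ℕD
open import Data.Integer as ℤ using (ℤ; +_)
open import Data.Integer.Divisibility using (_∣_)
open import Data.Rational as ℚ using (ℚ)
open import Data.List using (List; map; upTo; filter; length; concatMap; foldr; _∷_; [])
open import Data.Product using (_×_; _,_)
open import Relation.Nullary using (Dec; _×-dec_)
open import Relation.Unary using (Decidable)

infix 4 _≡_[mod_] _≡?_[mod_]

_≡_[mod_] : ℤ → ℤ → ℕ → Set
a ≡ b [mod q ] = (+ q) ∣ (a ℤ.- b)

_≡?_[mod_] : (a b : ℤ) (q : ℕ) → Dec (a ≡ b [mod q ])
a ≡? b [mod q ] = ℕD._∣?_ q (ℤ.∣ a ℤ.- b ∣)

range1 : ℕ → List ℕ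
range1 n = map suc (upTo n)

triples : ℕ → List (ℕ × ℕ × ℕ)
triples n = concatMap (λ x → concatMap (λ y → map (λ z → (x , y , z)) (range1 n)) (range1 n)) (range1 n)

sq : ℕ → ℤ
sq x = + (x ℕ.* x)

Cond : ℕ → ℤ → ℤ → ℕ × ℕ × ℕ → Set
Cond q c₁ c₂ (x , y , z) = (sq x ℤ.- sq y ≡ c₁ [mod q ]) × (sq y ℤ.- sq z ≡ c₂ [mod q ])

cond? : (q : ℕ) (c₁ c₂ : ℤ) → Decidable (Cond q c₁ c₂)
cond? q c₁ c₂ (x , y , z) = (sq x ℤ.- sq y ≡? c₁ [mod q ]) ×-dec (sq y ℤ.- sq z ≡? c₂ [mod q ])

infixr 8 _^ᵠ_
_^ᵠ_ : ℚ → ℕ → ℚ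
x ^ᵠ ℕ.zero = ℚ.1ℚ
x ^ᵠ suc n = x ℚ.* (x ^ᵠ n)

toℚ : ℕ → ℚ
toℚ n = + n ℚ./ 1

A : ℕ → ℕ → ℤ → ℤ → ℕ
A M q c₁ c₂ = length (filter (cond? q c₁ c₂) (triples M))

A₀ : ℕ → ℤ → ℤ → ℕ
A₀ q c₁ c₂ = A q q c₁ c₂

Δ : (M q : ℕ) → .{{_ : NonZero q}} → ℤ → ℤ → ℚ
Δ M q c₁ c₂ = ℚ.∣ toℚ (A M q c₁ c₂) ℚ.- ((+ M ℚ./ q) ^ᵠ 3) ℚ.* toℚ (A₀ q c₁ c₂) ∣

sumℚ : {X : Set} → (X → ℚ) → List X → ℚ
sumℚ f = foldr (λ x acc → f x ℚ.+ acc) ℚ.0ℚ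

{-# OPTIONS --safe #-}
module Submission where

-- Write a = A(M,q,c₁,c₂), b = A₀(q,c₁,c₂) and t = (M/q)³, so that Δ = |a − t b|.
-- Every triple lies in exactly one class (c₁,c₂), hence Σ a = M³ ≤ Σ a².  Modulo a
-- prime, z² ≡ y² − c has at most two roots z ∈ {1..q} (two roots add up to q), so
-- b ≤ 4q.  Since a² ≤ (a − t b)² + 2 t a b, summing gives M³ ≤ Σ Δ² + 8 t q M³, and
-- t q = M³/q² < 1/64 when M³ < q²/64; therefore Σ Δ² ≥ (7/8) M³.

open import Defs
open import Algebra.Bundles using (CommutativeSemiring; CommutativeRing)
import Algebra.Properties.CommutativeSemigroup as CommutativeSemigroupProperties
open import Data.Bool using (true; false)
open import Data.Empty using (⊥; ⊥-elim)
open import Data.Integer as ℤ using (ℤ; +_; 1ℤ)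
import Data.Integer.Properties as ℤ
import Data.Integer.Divisibility as ℤ∣
import Data.Integer.Divisibility.Signed as ℤ∣ˢ
open import Data.Integer.DivMod using (_%ℕ_; _/ℕ_; a≡a%ℕn+[a/ℕn]*n; n%ℕd<d)
open import Data.Integer.Tactic.RingSolver using (solve-∀)
open import Data.List using (List; []; _∷_; _++_; map; concatMap; foldr; filter; length; upTo)
open import Data.List.Properties using (length-map; length-upTo)
open import Data.List.Membership.Propositional using (_∈_)
import Data.List.Membership.Propositional.Properties as Membership
open import Data.List.Relation.Unary.All using ([]; _∷_)
open import Data.List.Relation.Unary.AllPairs as AllPairs using (AllPairs; []; _∷_)
import Data.List.Relation.Unary.AllPairs.Properties as AllPairs
open import Data.List.Relation.Unary.Any using (here; there)
open import Data.Nat as ℕ using (ℕ; zero; suc; z≤n; s≤s; NonZero)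
import Data.Nat.Properties as ℕ
open import Data.Nat.Divisibility as ℕ∣ using (_∣_; divides)
open import Data.Nat.Primality using (Prime; euclidsLemma; prime⇒nonZero)
open import Data.Product using (Σ; _×_; _,_)
open import Data.Rational as ℚ using (ℚ; Positive; 0ℚ; 1ℚ; toℚᵘ)
import Data.Rational.Properties as ℚ
open import Data.Rational.Solver using (module +-*-Solver)
import Data.Rational.Unnormalised as ℚᵘ
import Data.Rational.Unnormalised.Properties as ℚᵘ
open import Data.Sum using (inj₁; inj₂)
open import Function using (_∘_)
open import Level using (Level)
open import Relation.Binary.Core using (Rel; _Preserves₂_⟶_⟶_)
open import Relation.Binary.Definitions using (Reflexive)
open import Relation.Nullary using (¬_; Dec; yes; no; _because_; _×-dec_)
open import Relation.Unary using (Decidable)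

module ListSum {c ℓ} (R : CommutativeSemiring c ℓ) where

  open CommutativeSemiring R
  open CommutativeSemigroupProperties +-commutativeSemigroup using (interchange)

  private variable
    X Y : Set
    f g : X → Carrier

  ∑ : (X → Carrier) → List X → Carrier
  ∑ f = foldr (λ x s → f x + s) 0#

  infix 5 ∑-syntax
  ∑-syntax : List X → (X → Carrier) → Carrier
  ∑-syntax L f = ∑ f L
  syntax ∑-syntax L (λ x → e) = ∑[ x ∈ L ] e

  ∑-cong : (L : List X) → (∀ x → f x ≈ g x) → ∑ f L ≈ ∑ g L
  ∑-cong []      f≈g = refl
  ∑-cong (x ∷ L) f≈g = +-cong (f≈g x) (∑-cong L f≈g)

  ∑-zero : (L : List X) → ∑[ _ ∈ L ] 0# ≈ 0#
  ∑-zero []      = refl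
  ∑-zero (x ∷ L) = trans (+-identityˡ _) (∑-zero L)

  ∑-+ : (L : List X) → ∑[ x ∈ L ] (f x + g x) ≈ ∑ f L + ∑ g L
  ∑-+ []      = sym (+-identityˡ 0#)
  ∑-+ (x ∷ L) = trans (+-congˡ (∑-+ L)) (interchange _ _ _ _)

  ∑-*ˡ : ∀ k (L : List X) → ∑[ x ∈ L ] (k * f x) ≈ k * ∑ f L
  ∑-*ˡ k []      = sym (zeroʳ k)
  ∑-*ˡ k (x ∷ L) = trans (+-congˡ (∑-*ˡ k L)) (sym (distribˡ k _ _))

  ∑-*ʳ : ∀ k (L : List X) → ∑[ x ∈ L ] (f x * k) ≈ ∑ f L * k
  ∑-*ʳ k []      = sym (zeroˡ k)
  ∑-*ʳ k (x ∷ L) = trans (+-congˡ (∑-*ʳ k L)) (sym (distribʳ k _ _))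

  ∑-linear : ∀ (f : X → Carrier) k g (L : List X) → ∑[ x ∈ L ] (f x + k * g x) ≈ ∑ f L + k * ∑ g L
  ∑-linear f k g L = trans (∑-+ L) (+-congˡ (∑-*ˡ k L))

  ∑-swap : (f : X → Y → Carrier) (L : List X) (K : List Y) →
           ∑[ a ∈ L ] ∑[ b ∈ K ] f a b ≈ ∑[ b ∈ K ] ∑[ a ∈ L ] f a b
  ∑-swap f []      K = sym (∑-zero K)
  ∑-swap f (x ∷ L) K = trans (+-congˡ (∑-swap f L K)) (sym (∑-+ K))

  ∑-++ : (L K : List X) → ∑ f (L ++ K) ≈ ∑ f L + ∑ f K
  ∑-++ []      K = sym (+-identityˡ _)
  ∑-++ (x ∷ L) K = trans (+-congˡ (∑-++ L K)) (sym (+-assoc _ _ _))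

  ∑-map : (g : Y → X) (L : List Y) → ∑ f (map g L) ≈ ∑ (f ∘ g) L
  ∑-map g []      = refl
  ∑-map g (x ∷ L) = +-congˡ (∑-map g L)

  ∑-concatMap : (g : Y → List X) (L : List Y) → ∑ f (concatMap g L) ≈ ∑[ b ∈ L ] ∑ f (g b)
  ∑-concatMap g []      = refl
  ∑-concatMap g (x ∷ L) = trans (∑-++ (g x) _) (+-congˡ (∑-concatMap g L))

  module Monotone {ℓ′} (_≤_ : Rel Carrier ℓ′)
                  (≤-refl : Reflexive _≤_) (+-mono-≤ : _+_ Preserves₂ _≤_ ⟶ _≤_ ⟶ _≤_) where

    ∑-mono : (L : List X) → (∀ x → f x ≤ g x) → ∑ f L ≤ ∑ g L
    ∑-mono []      f≤g = ≤-refl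
    ∑-mono (x ∷ L) f≤g = +-mono-≤ (f≤g x) (∑-mono L f≤g)

open import Data.Nat using (_+_; _*_; _∸_; _^_; _≤_; _<_)
open import Relation.Binary.PropositionalEquality

module ℕ∑ = ListSum ℕ.+-*-commutativeSemiring
-- For this semiring ∑ unfolds to sumℚ, so the lemmas of ℚ∑ apply to sumℚ as they stand.
module ℚ∑ = ListSum (CommutativeRing.commutativeSemiring ℚ.+-*-commutativeRing)
open ℕ∑
open ℕ∑.Monotone _≤_ ℕ.≤-refl ℕ.+-mono-≤
open ℚ∑.Monotone ℚ._≤_ ℚ.≤-refl ℚ.+-mono-≤ renaming (∑-mono to ∑ℚ-mono)
open +-*-Solver

private variable
  X : Set
  P P′ : Set
  ℓ : Level

𝟙 : Dec P → ℕ
𝟙 (true  because _) = 1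
𝟙 (false because _) = 0

𝟙-×-dec : (p : Dec P) (q : Dec P′) → 𝟙 (p ×-dec q) ≡ 𝟙 p * 𝟙 q
𝟙-×-dec (true  because _) (true  because _) = refl
𝟙-×-dec (true  because _) (false because _) = refl
𝟙-×-dec (false because _) _                 = refl

length-filter : {P : X → Set} (P? : Decidable P) (L : List X) →
                length (filter P? L) ≡ ∑[ x ∈ L ] 𝟙 (P? x)
length-filter P? []      = refl
length-filter P? (x ∷ L) with P? x
... | yes _ = cong suc (length-filter P? L)
... | no  _ = length-filter P? L

length≤1 : {R : Rel X ℓ} {L : List X} → AllPairs R L →
           (∀ {x y} → x ∈ L → y ∈ L → R x y → ⊥) → length L ≤ 1
length≤1 []                  _     = z≤n
length≤1 ([] ∷ [])           _     = s≤s z≤n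
length≤1 ((Rxy ∷ _) ∷ _)     never = ⊥-elim (never (here refl) (there (here refl)) Rxy)

length≤2 : {R : Rel X ℓ} {L : List X} → AllPairs R L →
           (∀ {x y z} → x ∈ L → y ∈ L → z ∈ L → R x y → R x z → R y z → ⊥) → length L ≤ 2
length≤2 []                                  _     = z≤n
length≤2 ([] ∷ [])                           _     = s≤s z≤n
length≤2 ((_ ∷ []) ∷ [] ∷ [])                _     = s≤s (s≤s z≤n)
length≤2 ((Rxy ∷ Rxz ∷ _) ∷ (Ryz ∷ _) ∷ _)   never =
  ⊥-elim (never (here refl) (there (here refl)) (there (there (here refl))) Rxy Rxz Ryz)

1≤∑𝟙 : {P : X → Set} (P? : Decidable P) {L : List X} {x : X} → x ∈ L → P x → 1 ≤ ∑[ y ∈ L ] 𝟙 (P? y)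
1≤∑𝟙 P? {x ∷ L} (here refl) px with P? x
... | yes _   = s≤s z≤n
... | no ¬px = ⊥-elim (¬px px)
1≤∑𝟙 P? {y ∷ L} (there x∈L) px = ℕ.≤-trans (1≤∑𝟙 P? x∈L px) (ℕ.m≤n+m _ (𝟙 (P? y)))

module _ {P : ℕ → Set} (P? : Decidable P) {L : List ℕ} (L↑ : AllPairs _<_ L) where

  private
    filtered↑ : AllPairs _<_ (filter P? L)
    filtered↑ = AllPairs.filter⁺ P? L↑

    ∈-filter⁻ : ∀ {x} → x ∈ filter P? L → x ∈ L × P x
    ∈-filter⁻ = Membership.∈-filter⁻ P?

  ∑𝟙≤1 : (∀ {x y} → x ∈ L × P x → y ∈ L × P y → x < y → ⊥) → ∑[ x ∈ L ] 𝟙 (P? x) ≤ 1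
  ∑𝟙≤1 never = subst (_≤ 1) (length-filter P? L)
    (length≤1 filtered↑ λ x∈ y∈ → never (∈-filter⁻ x∈) (∈-filter⁻ y∈))

  ∑𝟙≤2 : (∀ {x y z} → x ∈ L × P x → y ∈ L × P y → z ∈ L × P z → x < y → x < z → y < z → ⊥) →
         ∑[ x ∈ L ] 𝟙 (P? x) ≤ 2
  ∑𝟙≤2 never = subst (_≤ 2) (length-filter P? L)
    (length≤2 filtered↑ λ x∈ y∈ z∈ → never (∈-filter⁻ x∈) (∈-filter⁻ y∈) (∈-filter⁻ z∈))

range1-↑ : ∀ n → AllPairs _<_ (range1 n)
range1-↑ n = AllPairs.map⁺ (AllPairs.map s≤s (AllPairs.applyUpTo⁺₁ (λ i → i) n (λ i<j _ → i<j)))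

∈-range1⁻ : ∀ {n z} → z ∈ range1 n → 1 ≤ z × z ≤ n
∈-range1⁻ z∈ with Membership.∈-map⁻ suc z∈
... | i , i∈ , refl = s≤s z≤n , Membership.∈-upTo⁻ i∈

∈-range1⁺ : ∀ {n z} → z < n → suc z ∈ range1 n
∈-range1⁺ z<n = Membership.∈-map⁺ suc (Membership.∈-upTo⁺ z<n)

∑-const : ∀ k (L : List X) → ∑[ _ ∈ L ] k ≡ length L * k
∑-const k []      = refl
∑-const k (x ∷ L) = cong (λ s → k + s) (∑-const k L)

length-range1 : ∀ n → length (range1 n) ≡ n
length-range1 n = trans (length-map suc (upTo n)) (length-upTo n)

∣m∣n⇒∣m-n : ∀ {q} m n → + q ℤ∣.∣ m → + q ℤ∣.∣ n → + q ℤ∣.∣ (m ℤ.- n)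
∣m∣n⇒∣m-n {q} m n q∣m q∣n =
  ℤ∣ˢ.∣⇒∣ᵤ {+ q} (ℤ∣ˢ.∣m∣n⇒∣m-n (ℤ∣ˢ.∣ᵤ⇒∣ {+ q} {m} q∣m) (ℤ∣ˢ.∣ᵤ⇒∣ {+ q} {n} q∣n))

∣[+m]-[+n]∣≡m∸n : ∀ {m n} → n ≤ m → ℤ.∣ + m ℤ.- + n ∣ ≡ m ∸ n
∣[+m]-[+n]∣≡m∸n {m} {n} n≤m = begin
  ℤ.∣ + m ℤ.- + n ∣  ≡⟨ cong ℤ.∣_∣ (ℤ.[+m]-[+n]≡m⊖n m n) ⟩
  ℤ.∣ m ℤ.⊖ n ∣      ≡⟨ ℤ.∣m⊖n∣≡∣n⊖m∣ m n ⟩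
  ℤ.∣ n ℤ.⊖ m ∣      ≡⟨ ℤ.∣⊖∣-≤ n≤m ⟩
  m ∸ n              ∎
  where open ≡-Reasoning

¬q∣y∸x : ∀ {q x y} → 1 ≤ x → x < y → y ≤ q → ¬ (q ∣ y ∸ x)
¬q∣y∸x {q} {x} {y} 1≤x x<y y≤q q∣y∸x = ℕ.<⇒≱ y∸x<q (ℕ∣.∣⇒≤ q∣y∸x)
  where
  instance
    y∸x≢0 : NonZero (y ∸ x)
    y∸x≢0 = ℕ.>-nonZero (ℕ.m<n⇒0<n∸m x<y)
  y∸x<q : y ∸ x < q
  y∸x<q = ℕ.≤-trans (ℕ.∸-monoʳ-< 1≤x (ℕ.<⇒≤ x<y)) y≤q

¬q∣[+y]-[+x] : ∀ {q x y} → 1 ≤ x → x < y → y ≤ q → ¬ (+ q ℤ∣.∣ (+ y ℤ.- + x))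
¬q∣[+y]-[+x] 1≤x x<y y≤q q∣y-x =
  ¬q∣y∸x 1≤x x<y y≤q (subst (_ ∣_) (∣[+m]-[+n]∣≡m∸n (ℕ.<⇒≤ x<y)) q∣y-x)

difference-of-squares : ∀ a b → a ℤ.* a ℤ.- b ℤ.* b ≡ (a ℤ.- b) ℤ.* (a ℤ.+ b)
difference-of-squares = solve-∀

∣sq[y]-sq[x]∣≡∣y-x∣*[y+x] : ∀ x y → ℤ.∣ sq y ℤ.- sq x ∣ ≡ ℤ.∣ + y ℤ.- + x ∣ * (y + x)
∣sq[y]-sq[x]∣≡∣y-x∣*[y+x] x y = begin
  ℤ.∣ + (y * y) ℤ.- + (x * x) ∣                ≡⟨ cong ℤ.∣_∣ (cong₂ ℤ._-_ (ℤ.pos-* y y) (ℤ.pos-* x x)) ⟩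
  ℤ.∣ + y ℤ.* + y ℤ.- + x ℤ.* + x ∣            ≡⟨ cong ℤ.∣_∣ (difference-of-squares (+ y) (+ x)) ⟩
  ℤ.∣ (+ y ℤ.- + x) ℤ.* (+ y ℤ.+ + x) ∣        ≡⟨ ℤ.abs-* (+ y ℤ.- + x) (+ y ℤ.+ + x) ⟩
  ℤ.∣ + y ℤ.- + x ∣ * ℤ.∣ + y ℤ.+ + x ∣        ≡⟨ cong (λ s → ℤ.∣ + y ℤ.- + x ∣ * ℤ.∣ s ∣) (ℤ.pos-+ y x) ⟨
  ℤ.∣ + y ℤ.- + x ∣ * (y + x)                  ∎
  where open ≡-Reasoning

m∣n∧0<n<m+m⇒n≡m : ∀ {m n} → m ∣ n → 0 < n → n < m + m → n ≡ m
m∣n∧0<n<m+m⇒n≡m {m} (divides zero          refl) ()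
m∣n∧0<n<m+m⇒n≡m {m} (divides (suc zero)    refl) _ _ = ℕ.+-identityʳ m
m∣n∧0<n<m+m⇒n≡m {m} (divides (suc (suc k)) refl) _ n<m+m =
  ⊥-elim (ℕ.<⇒≱ n<m+m (ℕ.+-monoʳ-≤ m (ℕ.m≤m+n m (k * m))))

sq≡sq[mod]⇒y+x≡q : ∀ {q x y} → Prime q → 1 ≤ x → x < y → y ≤ q →
                   + q ℤ∣.∣ (sq y ℤ.- sq x) → y + x ≡ q
sq≡sq[mod]⇒y+x≡q {q} {x} {y} q-prime 1≤x x<y y≤q q∣sq[y]-sq[x]
  with euclidsLemma (y ∸ x) (y + x) q-prime q∣[y∸x][y+x]
  where
  q∣[y∸x][y+x] : q ∣ (y ∸ x) * (y + x)
  q∣[y∸x][y+x] = subst (q ∣_)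
    (trans (∣sq[y]-sq[x]∣≡∣y-x∣*[y+x] x y) (cong (_* (y + x)) (∣[+m]-[+n]∣≡m∸n (ℕ.<⇒≤ x<y)))) q∣sq[y]-sq[x]
... | inj₁ q∣y∸x = ⊥-elim (¬q∣y∸x 1≤x x<y y≤q q∣y∸x)
... | inj₂ q∣y+x = m∣n∧0<n<m+m⇒n≡m q∣y+x (ℕ.≤-trans 1≤x (ℕ.m≤n+m x y))
                     (ℕ.+-mono-≤-< y≤q (ℕ.<-≤-trans x<y y≤q))

a≡suc[[a-1]%ℕq] : ∀ q .{{_ : NonZero q}} (a : ℤ) → a ≡ + suc ((a ℤ.- 1ℤ) %ℕ q) [mod q ]
a≡suc[[a-1]%ℕq] q a = ℤ∣ˢ.∣⇒∣ᵤ {+ q} (ℤ∣ˢ.divides K (begin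
  a ℤ.- + suc r                  ≡⟨ cong (λ n → a ℤ.- n) (ℤ.pos-+ 1 r) ⟩
  a ℤ.- (1ℤ ℤ.+ + r)             ≡⟨ shift a (+ r) ⟩
  (a ℤ.- 1ℤ) ℤ.- + r             ≡⟨ cong (ℤ._- + r) (a≡a%ℕn+[a/ℕn]*n (a ℤ.- 1ℤ) q) ⟩
  (+ r ℤ.+ K ℤ.* + q) ℤ.- + r    ≡⟨ cancel (+ r) (K ℤ.* + q) ⟩
  K ℤ.* + q                      ∎))
  where
  open ≡-Reasoning
  r : ℕ
  r = (a ℤ.- 1ℤ) %ℕ q
  K : ℤ
  K = (a ℤ.- 1ℤ) /ℕ q
  shift : ∀ a r → a ℤ.- (1ℤ ℤ.+ r) ≡ (a ℤ.- 1ℤ) ℤ.- r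
  shift = solve-∀
  cancel : ∀ r k → (r ℤ.+ k) ℤ.- r ≡ k
  cancel = solve-∀

∑-residues≡1 : ∀ q .{{_ : NonZero q}} (a : ℤ) → ∑[ c ∈ range1 q ] 𝟙 (a ≡? + c [mod q ]) ≡ 1
∑-residues≡1 q a = ℕ.≤-antisym (∑𝟙≤1 residue? (range1-↑ q) incongruent)
  (1≤∑𝟙 residue? (∈-range1⁺ (n%ℕd<d (a ℤ.- 1ℤ) q)) (a≡suc[[a-1]%ℕq] q a))
  where
  residue? : Decidable (λ c → a ≡ + c [mod q ])
  residue? c = a ≡? + c [mod q ]
  swap-difference : ∀ a x y → (a ℤ.- x) ℤ.- (a ℤ.- y) ≡ y ℤ.- x
  swap-difference = solve-∀
  Residue : ℕ → Set
  Residue c = c ∈ range1 q × a ≡ + c [mod q ]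
  incongruent : ∀ {x y} → Residue x → Residue y → x < y → ⊥
  incongruent {x} {y} (x∈ , a≡x) (y∈ , a≡y) x<y with ∈-range1⁻ x∈ | ∈-range1⁻ y∈
  ... | 1≤x , _ | _ , y≤q = ¬q∣[+y]-[+x] 1≤x x<y y≤q
    (subst (+ q ℤ∣.∣_) (swap-difference a (+ x) (+ y)) (∣m∣n⇒∣m-n (a ℤ.- + x) (a ℤ.- + y) a≡x a≡y))

∑-square-roots≤2 : ∀ {q} → Prime q → (a c : ℤ) → ∑[ z ∈ range1 q ] 𝟙 (a ℤ.- sq z ≡? c [mod q ]) ≤ 2
∑-square-roots≤2 {q} q-prime a c = ∑𝟙≤2 root? (range1-↑ q) no-three-roots
  where
  root? : Decidable (λ z → a ℤ.- sq z ≡ c [mod q ])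
  root? z = a ℤ.- sq z ≡? c [mod q ]
  swap-difference : ∀ a c x y → ((a ℤ.- x) ℤ.- c) ℤ.- ((a ℤ.- y) ℤ.- c) ≡ y ℤ.- x
  swap-difference = solve-∀
  Root : ℕ → Set
  Root z = z ∈ range1 q × a ℤ.- sq z ≡ c [mod q ]
  root-pair : ∀ {x y} → Root x → Root y → x < y → y + x ≡ q
  root-pair {x} {y} (x∈ , x-root) (y∈ , y-root) x<y with ∈-range1⁻ x∈ | ∈-range1⁻ y∈
  ... | 1≤x , _ | _ , y≤q = sq≡sq[mod]⇒y+x≡q q-prime 1≤x x<y y≤q
    (subst (+ q ℤ∣.∣_) (swap-difference a c (sq x) (sq y))
           (∣m∣n⇒∣m-n (a ℤ.- sq x ℤ.- c) (a ℤ.- sq y ℤ.- c) x-root y-root))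
  no-three-roots : ∀ {x y z} → Root x → Root y → Root z → x < y → x < z → y < z → ⊥
  no-three-roots {x} {y} {z} x-root y-root z-root x<y x<z y<z =
    ℕ.<-irrefl (ℕ.+-cancelʳ-≡ x y z (trans (root-pair x-root y-root x<y) (sym (root-pair x-root z-root x<z)))) y<z

δ : ℕ → ℤ → ℕ → ℕ → ℕ
δ q c x y = 𝟙 (sq x ℤ.- sq y ≡? c [mod q ])

∑-range1-const : ∀ n k → ∑[ _ ∈ range1 n ] k ≡ n * k
∑-range1-const n k = trans (∑-const k (range1 n)) (cong (_* k) (length-range1 n))

∑-triples : ∀ M (f : ℕ × ℕ × ℕ → ℕ) →
            ∑ f (triples M) ≡ ∑[ x ∈ range1 M ] ∑[ y ∈ range1 M ] ∑[ z ∈ range1 M ] f (x , y , z)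
∑-triples M f = trans (∑-concatMap _ R) (∑-cong R λ x → trans (∑-concatMap _ R) (∑-cong R λ y → ∑-map _ R))
  where
  R : List ℕ
  R = range1 M

count-triples : ∀ M → ∑[ _ ∈ triples M ] 1 ≡ M ^ 3
count-triples M = trans (∑-triples M _)
  (trans (∑-cong R λ x → trans (∑-cong R λ y → ∑-range1-const M 1) (∑-range1-const M (M * 1)))
         (∑-range1-const M (M * (M * 1))))
  where
  R : List ℕ
  R = range1 M

𝟙-cond : ∀ q c₁ c₂ x y z → 𝟙 (cond? q c₁ c₂ (x , y , z)) ≡ δ q c₁ x y * δ q c₂ y z
𝟙-cond q c₁ c₂ x y z = 𝟙-×-dec (sq x ℤ.- sq y ≡? c₁ [mod q ]) (sq y ℤ.- sq z ≡? c₂ [mod q ])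

A≡∑δδ : ∀ M q c₁ c₂ →
        A M q c₁ c₂ ≡ ∑[ x ∈ range1 M ] ∑[ y ∈ range1 M ] ∑[ z ∈ range1 M ] δ q c₁ x y * δ q c₂ y z
A≡∑δδ M q c₁ c₂ = trans (length-filter (cond? q c₁ c₂) (triples M))
  (trans (∑-triples M _) (∑-cong R λ x → ∑-cong R λ y → ∑-cong R λ z → 𝟙-cond q c₁ c₂ x y z))
  where
  R : List ℕ
  R = range1 M

module _ (q : ℕ) .{{_ : NonZero q}} where

  private
    C : List ℕ
    C = range1 q

  each-triple-in-one-class : ∀ t → ∑[ c₁ ∈ C ] ∑[ c₂ ∈ C ] 𝟙 (cond? q (+ c₁) (+ c₂) t) ≡ 1
  each-triple-in-one-class (x , y , z) = begin
    ∑[ c₁ ∈ C ] ∑[ c₂ ∈ C ] 𝟙 (cond? q (+ c₁) (+ c₂) (x , y , z))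
      ≡⟨ ∑-cong C (λ c₁ → ∑-cong C λ c₂ → 𝟙-cond q (+ c₁) (+ c₂) x y z) ⟩
    ∑[ c₁ ∈ C ] ∑[ c₂ ∈ C ] δ q (+ c₁) x y * δ q (+ c₂) y z
      ≡⟨ ∑-cong C (λ c₁ → ∑-*ˡ (δ q (+ c₁) x y) C) ⟩
    ∑[ c₁ ∈ C ] δ q (+ c₁) x y * (∑[ c₂ ∈ C ] δ q (+ c₂) y z)
      ≡⟨ ∑-*ʳ _ C ⟩
    (∑[ c₁ ∈ C ] δ q (+ c₁) x y) * (∑[ c₂ ∈ C ] δ q (+ c₂) y z)
      ≡⟨ cong₂ _*_ (∑-residues≡1 q (sq x ℤ.- sq y)) (∑-residues≡1 q (sq y ℤ.- sq z)) ⟩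
    1 ∎
    where open ≡-Reasoning

  ∑∑A≡M^3 : ∀ M → ∑[ c₁ ∈ C ] ∑[ c₂ ∈ C ] A M q (+ c₁) (+ c₂) ≡ M ^ 3
  ∑∑A≡M^3 M = begin
    ∑[ c₁ ∈ C ] ∑[ c₂ ∈ C ] A M q (+ c₁) (+ c₂)
      ≡⟨ ∑-cong C (λ c₁ → ∑-cong C λ c₂ → length-filter (cond? q (+ c₁) (+ c₂)) T) ⟩
    ∑[ c₁ ∈ C ] ∑[ c₂ ∈ C ] ∑[ t ∈ T ] 𝟙 (cond? q (+ c₁) (+ c₂) t)
      ≡⟨ ∑-cong C (λ c₁ → ∑-swap _ C T) ⟩
    ∑[ c₁ ∈ C ] ∑[ t ∈ T ] ∑[ c₂ ∈ C ] 𝟙 (cond? q (+ c₁) (+ c₂) t)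
      ≡⟨ ∑-swap _ C T ⟩
    ∑[ t ∈ T ] ∑[ c₁ ∈ C ] ∑[ c₂ ∈ C ] 𝟙 (cond? q (+ c₁) (+ c₂) t)
      ≡⟨ ∑-cong T each-triple-in-one-class ⟩
    ∑[ _ ∈ T ] 1
      ≡⟨ count-triples M ⟩
    M ^ 3 ∎
    where
    open ≡-Reasoning
    T : List (ℕ × ℕ × ℕ)
    T = triples M

A₀≤q*4 : ∀ {q} → Prime q → ∀ c₁ c₂ → A₀ q c₁ c₂ ≤ q * 4
A₀≤q*4 {q} q-prime c₁ c₂ = begin
  A₀ q c₁ c₂
    ≡⟨ A≡∑δδ q q c₁ c₂ ⟩
  ∑[ x ∈ R ] ∑[ y ∈ R ] ∑[ z ∈ R ] δ q c₁ x y * δ q c₂ y z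
    ≡⟨ ∑-cong R (λ x → ∑-cong R λ y → ∑-*ˡ (δ q c₁ x y) R) ⟩
  ∑[ x ∈ R ] ∑[ y ∈ R ] δ q c₁ x y * (∑[ z ∈ R ] δ q c₂ y z)
    ≤⟨ ∑-mono R (λ x → ∑-mono R λ y → ℕ.*-monoʳ-≤ (δ q c₁ x y) (∑-square-roots≤2 q-prime (sq y) c₂)) ⟩
  ∑[ x ∈ R ] ∑[ y ∈ R ] δ q c₁ x y * 2
    ≡⟨ ∑-cong R (λ x → ∑-*ʳ 2 R) ⟩
  ∑[ x ∈ R ] (∑[ y ∈ R ] δ q c₁ x y) * 2
    ≤⟨ ∑-mono R (λ x → ℕ.*-monoˡ-≤ 2 (∑-square-roots≤2 q-prime (sq x) c₁)) ⟩
  ∑[ _ ∈ R ] 4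
    ≡⟨ ∑-range1-const q 4 ⟩
  q * 4 ∎
  where
  open ℕ.≤-Reasoning
  R : List ℕ
  R = range1 q

toℚᵘ-toℚ : ∀ n → toℚᵘ (toℚ n) ℚᵘ.≃ ℚᵘ.mkℚᵘ (+ n) 0
toℚᵘ-toℚ n = ℚ.toℚᵘ-fromℚᵘ (ℚᵘ.mkℚᵘ (+ n) 0)

toℚ-+ : ∀ m n → toℚ (m + n) ≡ toℚ m ℚ.+ toℚ n
toℚ-+ m n = ℚ.toℚᵘ-injective (begin
  toℚᵘ (toℚ (m + n))                    ≈⟨ toℚᵘ-toℚ (m + n) ⟩
  ℚᵘ.mkℚᵘ (+ (m + n)) 0                 ≈⟨ ℚᵘ.*≡* (trans (cong (ℤ._* + 1) (ℤ.pos-+ m n)) (sum-over-1 (+ m) (+ n))) ⟩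
  ℚᵘ.mkℚᵘ (+ m) 0 ℚᵘ.+ ℚᵘ.mkℚᵘ (+ n) 0  ≈⟨ ℚᵘ.+-cong (toℚᵘ-toℚ m) (toℚᵘ-toℚ n) ⟨
  toℚᵘ (toℚ m) ℚᵘ.+ toℚᵘ (toℚ n)        ≈⟨ ℚ.toℚᵘ-homo-+ (toℚ m) (toℚ n) ⟨
  toℚᵘ (toℚ m ℚ.+ toℚ n)                ∎)
  where
  open ℚᵘ.≃-Reasoning
  sum-over-1 : ∀ a b → (a ℤ.+ b) ℤ.* + 1 ≡ (a ℤ.* + 1 ℤ.+ b ℤ.* + 1) ℤ.* + 1
  sum-over-1 = solve-∀

toℚ-* : ∀ m n → toℚ (m * n) ≡ toℚ m ℚ.* toℚ n
toℚ-* m n = ℚ.toℚᵘ-injective (begin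
  toℚᵘ (toℚ (m * n))                    ≈⟨ toℚᵘ-toℚ (m * n) ⟩
  ℚᵘ.mkℚᵘ (+ (m * n)) 0                 ≈⟨ ℚᵘ.*≡* (cong (ℤ._* + 1) (ℤ.pos-* m n)) ⟩
  ℚᵘ.mkℚᵘ (+ m) 0 ℚᵘ.* ℚᵘ.mkℚᵘ (+ n) 0  ≈⟨ ℚᵘ.*-cong (toℚᵘ-toℚ m) (toℚᵘ-toℚ n) ⟨
  toℚᵘ (toℚ m) ℚᵘ.* toℚᵘ (toℚ n)        ≈⟨ ℚ.toℚᵘ-homo-* (toℚ m) (toℚ n) ⟨
  toℚᵘ (toℚ m ℚ.* toℚ n)                ∎)
  where open ℚᵘ.≃-Reasoning

[m/n]*n≡m : ∀ m n .{{_ : NonZero n}} → (+ m ℚ./ n) ℚ.* toℚ n ≡ toℚ m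
[m/n]*n≡m m (suc n) = ℚ.toℚᵘ-injective (begin
  toℚᵘ ((+ m ℚ./ suc n) ℚ.* toℚ (suc n))       ≈⟨ ℚ.toℚᵘ-homo-* (+ m ℚ./ suc n) (toℚ (suc n)) ⟩
  toℚᵘ (+ m ℚ./ suc n) ℚᵘ.* toℚᵘ (toℚ (suc n))  ≈⟨ ℚᵘ.*-cong (ℚ.toℚᵘ-fromℚᵘ (ℚᵘ.mkℚᵘ (+ m) n)) (toℚᵘ-toℚ (suc n)) ⟩
  ℚᵘ.mkℚᵘ (+ m) n ℚᵘ.* ℚᵘ.mkℚᵘ (+ suc n) 0      ≈⟨ ℚᵘ.*≡* (*-assoc (+ m) (+ suc n)) ⟩
  ℚᵘ.mkℚᵘ (+ m) 0                               ≈⟨ toℚᵘ-toℚ m ⟨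
  toℚᵘ (toℚ m)                                  ∎)
  where
  open ℚᵘ.≃-Reasoning
  *-assoc : ∀ a b → (a ℤ.* b) ℤ.* + 1 ≡ a ℤ.* (b ℤ.* + 1)
  *-assoc = solve-∀

0≤toℚ : ∀ n → 0ℚ ℚ.≤ toℚ n
0≤toℚ n = ℚ.nonNegative⁻¹ (toℚ n) {{ℚ.normalize-nonNeg n 1}}

toℚ-mono-≤ : ∀ {m n} → m ≤ n → toℚ m ℚ.≤ toℚ n
toℚ-mono-≤ {m} {n} m≤n = begin
  toℚ m                  ≡⟨ ℚ.+-identityʳ (toℚ m) ⟨
  toℚ m ℚ.+ 0ℚ           ≤⟨ ℚ.+-monoʳ-≤ (toℚ m) (0≤toℚ (n ∸ m)) ⟩
  toℚ m ℚ.+ toℚ (n ∸ m)  ≡⟨ toℚ-+ m (n ∸ m) ⟨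
  toℚ (m + (n ∸ m))      ≡⟨ cong toℚ (ℕ.m+[n∸m]≡n m≤n) ⟩
  toℚ n                  ∎
  where open ℚ.≤-Reasoning

toℚ-∑ : ∀ {X : Set} (f : X → ℕ) (L : List X) → toℚ (∑ f L) ≡ sumℚ (toℚ ∘ f) L
toℚ-∑ f []      = refl
toℚ-∑ f (x ∷ L) = trans (toℚ-+ (f x) (∑ f L)) (cong (λ s → toℚ (f x) ℚ.+ s) (toℚ-∑ f L))

0≤p*q : ∀ {p q} → 0ℚ ℚ.≤ p → 0ℚ ℚ.≤ q → 0ℚ ℚ.≤ p ℚ.* q
0≤p*q {p} {q} 0≤p 0≤q = ℚ.nonNegative⁻¹ (p ℚ.* q)
  {{ℚ.nonNeg*nonNeg⇒nonNeg p {{ℚ.nonNegative 0≤p}} q {{ℚ.nonNegative 0≤q}}}}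

∣p∣*∣p∣≡p*p : ∀ p → ℚ.∣ p ∣ ℚ.* ℚ.∣ p ∣ ≡ p ℚ.* p
∣p∣*∣p∣≡p*p p with ℚ.∣p∣≡p∨∣p∣≡-p p
... | inj₁ ∣p∣≡p  rewrite ∣p∣≡p  = refl
... | inj₂ ∣p∣≡-p rewrite ∣p∣≡-p = solve 1 (λ p → (:- p) :* (:- p) := p :* p) refl p

0≤p*p : ∀ p → 0ℚ ℚ.≤ p ℚ.* p
0≤p*p p = subst (0ℚ ℚ.≤_) (∣p∣*∣p∣≡p*p p) (0≤p*q (ℚ.0≤∣p∣ p) (ℚ.0≤∣p∣ p))

a²≤∣a-tb∣²+2tab : ∀ a b t → a ℚ.* a ℚ.≤ ℚ.∣ a ℚ.- t ℚ.* b ∣ ^ᵠ 2 ℚ.+ (t ℚ.+ t) ℚ.* (a ℚ.* b)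
a²≤∣a-tb∣²+2tab a b t = begin
  a ℚ.* a
    ≡⟨ ℚ.+-identityʳ (a ℚ.* a) ⟨
  a ℚ.* a ℚ.+ 0ℚ
    ≤⟨ ℚ.+-monoʳ-≤ (a ℚ.* a) (0≤p*p (t ℚ.* b)) ⟩
  a ℚ.* a ℚ.+ (t ℚ.* b) ℚ.* (t ℚ.* b)
    ≡⟨ expand a b t ⟩
  (a ℚ.- t ℚ.* b) ℚ.* (a ℚ.- t ℚ.* b) ℚ.+ (t ℚ.+ t) ℚ.* (a ℚ.* b)
    ≡⟨ cong (ℚ._+ (t ℚ.+ t) ℚ.* (a ℚ.* b)) (∣p∣*∣p∣≡p*p (a ℚ.- t ℚ.* b)) ⟨
  ℚ.∣ a ℚ.- t ℚ.* b ∣ ℚ.* ℚ.∣ a ℚ.- t ℚ.* b ∣ ℚ.+ (t ℚ.+ t) ℚ.* (a ℚ.* b)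
    ≡⟨ cong (λ d → d ℚ.+ (t ℚ.+ t) ℚ.* (a ℚ.* b)) (cong (ℚ.∣ a ℚ.- t ℚ.* b ∣ ℚ.*_) (ℚ.*-identityʳ _)) ⟨
  ℚ.∣ a ℚ.- t ℚ.* b ∣ ^ᵠ 2 ℚ.+ (t ℚ.+ t) ℚ.* (a ℚ.* b)
    ∎
  where
  open ℚ.≤-Reasoning
  expand : ∀ a b t → a ℚ.* a ℚ.+ (t ℚ.* b) ℚ.* (t ℚ.* b) ≡ (a ℚ.- t ℚ.* b) ℚ.* (a ℚ.- t ℚ.* b) ℚ.+ (t ℚ.+ t) ℚ.* (a ℚ.* b)
  expand = solve 3 (λ a b t → a :* a :+ (t :* b) :* (t :* b) := (a :- t :* b) :* (a :- t :* b) :+ (t :+ t) :* (a :* b)) refl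

1/4 1/8 7/8 : ℚ
1/4 = + 1 ℚ./ 4
1/8 = + 1 ℚ./ 8
7/8 = + 7 ℚ./ 8

m≤X+k*m⇒7/8*m≤X : ∀ {m X k} → 0ℚ ℚ.≤ m → k ℚ.≤ 1/8 → m ℚ.≤ X ℚ.+ k ℚ.* m → 7/8 ℚ.* m ℚ.≤ X
m≤X+k*m⇒7/8*m≤X {m} {X} {k} 0≤m k≤1/8 m≤X+km = begin
  7/8 ℚ.* m                      ≡⟨ seven-eighths m ⟩
  m ℚ.- 1/8 ℚ.* m                ≤⟨ ℚ.+-monoˡ-≤ (ℚ.- (1/8 ℚ.* m)) m≤X+km ⟩
  X ℚ.+ k ℚ.* m ℚ.- 1/8 ℚ.* m    ≤⟨ ℚ.+-monoˡ-≤ (ℚ.- (1/8 ℚ.* m)) (ℚ.+-monoʳ-≤ X km≤m/8) ⟩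
  X ℚ.+ 1/8 ℚ.* m ℚ.- 1/8 ℚ.* m  ≡⟨ cancel X (1/8 ℚ.* m) ⟩
  X                              ∎
  where
  open ℚ.≤-Reasoning
  km≤m/8 : k ℚ.* m ℚ.≤ 1/8 ℚ.* m
  km≤m/8 = ℚ.*-monoʳ-≤-nonNeg m {{ℚ.nonNegative 0≤m}} k≤1/8
  seven-eighths : ∀ m → 7/8 ℚ.* m ≡ m ℚ.- 1/8 ℚ.* m
  seven-eighths = solve 1 (λ m → con 7/8 :* m := m :- con 1/8 :* m) refl
  cancel : ∀ X y → X ℚ.+ y ℚ.- y ≡ X
  cancel = solve 2 (λ X y → X :+ y :- y := X) refl

0≤p^ᵠn : ∀ {p} → 0ℚ ℚ.≤ p → ∀ n → 0ℚ ℚ.≤ p ^ᵠ n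
0≤p^ᵠn 0≤p zero    = ℚ.nonNegative⁻¹ 1ℚ
0≤p^ᵠn 0≤p (suc n) = 0≤p*q 0≤p (0≤p^ᵠn 0≤p n)

n≤n*n : ∀ n → n ≤ n * n
n≤n*n zero        = z≤n
n≤n*n n@(suc _)   = ℕ.m≤m*n n n

module _ (q : ℕ) .{{_ : NonZero q}} (q-prime : Prime q) (M : ℕ) where

  private
    C : List ℕ
    C = range1 q
    Q t ∑∑Δ² : ℚ
    Q = toℚ q
    a b : ℕ → ℕ → ℕ
    a c₁ c₂ = A M q (+ c₁) (+ c₂)
    b c₁ c₂ = A₀ q (+ c₁) (+ c₂)
    t = (+ M ℚ./ q) ^ᵠ 3
    ∑∑Δ² = sumℚ (λ c₁ → sumℚ (λ c₂ → Δ M q (+ c₁) (+ c₂) ^ᵠ 2) C) C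

  M^3≤∑∑A² : M ^ 3 ≤ ∑[ c₁ ∈ C ] ∑[ c₂ ∈ C ] a c₁ c₂ * a c₁ c₂
  M^3≤∑∑A² = ℕ.≤-trans (ℕ.≤-reflexive (sym (∑∑A≡M^3 q M))) (∑-mono C λ c₁ → ∑-mono C λ c₂ → n≤n*n (a c₁ c₂))

  ∑∑AA₀≤M^3*q*4 : ∑[ c₁ ∈ C ] ∑[ c₂ ∈ C ] a c₁ c₂ * b c₁ c₂ ≤ M ^ 3 * (q * 4)
  ∑∑AA₀≤M^3*q*4 = begin
    ∑[ c₁ ∈ C ] ∑[ c₂ ∈ C ] a c₁ c₂ * b c₁ c₂
      ≤⟨ ∑-mono C (λ c₁ → ∑-mono C λ c₂ → ℕ.*-monoʳ-≤ (a c₁ c₂) (A₀≤q*4 q-prime (+ c₁) (+ c₂))) ⟩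
    ∑[ c₁ ∈ C ] ∑[ c₂ ∈ C ] a c₁ c₂ * (q * 4)
      ≡⟨ trans (∑-cong C λ c₁ → ∑-*ʳ (q * 4) C) (∑-*ʳ (q * 4) C) ⟩
    (∑[ c₁ ∈ C ] ∑[ c₂ ∈ C ] a c₁ c₂) * (q * 4)
      ≡⟨ cong (_* (q * 4)) (∑∑A≡M^3 q M) ⟩
    M ^ 3 * (q * 4) ∎
    where open ℕ.≤-Reasoning

  toℚ-∑∑* : ∀ (f g : ℕ → ℕ → ℕ) →
            toℚ (∑[ c₁ ∈ C ] ∑[ c₂ ∈ C ] f c₁ c₂ * g c₁ c₂) ≡
            sumℚ (λ c₁ → sumℚ (λ c₂ → toℚ (f c₁ c₂) ℚ.* toℚ (g c₁ c₂)) C) C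
  toℚ-∑∑* f g = trans (toℚ-∑ _ C) (ℚ∑.∑-cong C λ c₁ →
    trans (toℚ-∑ _ C) (ℚ∑.∑-cong C λ c₂ → toℚ-* (f c₁ c₂) (g c₁ c₂)))

  ∑∑A²≤∑∑Δ²+2t∑∑AA₀ : toℚ (∑[ c₁ ∈ C ] ∑[ c₂ ∈ C ] a c₁ c₂ * a c₁ c₂) ℚ.≤
                       ∑∑Δ² ℚ.+ (t ℚ.+ t) ℚ.* toℚ (∑[ c₁ ∈ C ] ∑[ c₂ ∈ C ] a c₁ c₂ * b c₁ c₂)
  ∑∑A²≤∑∑Δ²+2t∑∑AA₀ = begin
    toℚ (∑[ c₁ ∈ C ] ∑[ c₂ ∈ C ] a c₁ c₂ * a c₁ c₂)
      ≡⟨ toℚ-∑∑* a a ⟩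
    sumℚ (λ c₁ → sumℚ (λ c₂ → toℚ (a c₁ c₂) ℚ.* toℚ (a c₁ c₂)) C) C
      ≤⟨ ∑ℚ-mono C (λ c₁ → ∑ℚ-mono C λ c₂ → a²≤∣a-tb∣²+2tab (toℚ (a c₁ c₂)) (toℚ (b c₁ c₂)) t) ⟩
    sumℚ (λ c₁ → sumℚ (λ c₂ → Δ M q (+ c₁) (+ c₂) ^ᵠ 2 ℚ.+ (t ℚ.+ t) ℚ.* (toℚ (a c₁ c₂) ℚ.* toℚ (b c₁ c₂))) C) C
      ≡⟨ trans (ℚ∑.∑-cong C λ c₁ → ℚ∑.∑-linear (Δ² c₁) (t ℚ.+ t) (toℚAB c₁) C) (ℚ∑.∑-linear (λ c₁ → sumℚ (Δ² c₁) C) (t ℚ.+ t) (λ c₁ → sumℚ (toℚAB c₁) C) C) ⟩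
    ∑∑Δ² ℚ.+ (t ℚ.+ t) ℚ.* sumℚ (λ c₁ → sumℚ (λ c₂ → toℚ (a c₁ c₂) ℚ.* toℚ (b c₁ c₂)) C) C
      ≡⟨ cong (λ s → ∑∑Δ² ℚ.+ (t ℚ.+ t) ℚ.* s) (toℚ-∑∑* a b) ⟨
    ∑∑Δ² ℚ.+ (t ℚ.+ t) ℚ.* toℚ (∑[ c₁ ∈ C ] ∑[ c₂ ∈ C ] a c₁ c₂ * b c₁ c₂) ∎
    where
    open ℚ.≤-Reasoning
    Δ² toℚAB : ℕ → ℕ → ℚ
    Δ² c₁ c₂ = Δ M q (+ c₁) (+ c₂) ^ᵠ 2
    toℚAB c₁ c₂ = toℚ (a c₁ c₂) ℚ.* toℚ (b c₁ c₂)

  private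
    0≤t : 0ℚ ℚ.≤ t
    0≤t = 0≤p^ᵠn (ℚ.nonNegative⁻¹ (+ M ℚ./ q) {{ℚ.normalize-nonNeg M q}}) 3

  t*q<[1/4]³ : toℚ M ^ᵠ 3 ℚ.< 1/4 ^ᵠ 3 ℚ.* toℚ (q ^ 2) → t ℚ.* Q ℚ.< 1/4 ^ᵠ 3
  t*q<[1/4]³ M-small = ℚ.*-cancelʳ-<-nonNeg (Q ℚ.* (Q ℚ.* 1ℚ)) {{ℚ.nonNegative (0≤p^ᵠn (0≤toℚ q) 2)}}
    (subst₂ ℚ._<_ (sym tQ³≡M³) (cong (1/4 ^ᵠ 3 ℚ.*_) toℚ[q^2]) M-small)
    where
    u : ℚ
    u = + M ℚ./ q
    toℚ[q^2] : toℚ (q ^ 2) ≡ Q ℚ.* (Q ℚ.* 1ℚ)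
    toℚ[q^2] = trans (toℚ-* q (q * 1)) (cong (Q ℚ.*_) (toℚ-* q 1))
    cube : ∀ u Q → u ℚ.* (u ℚ.* (u ℚ.* 1ℚ)) ℚ.* Q ℚ.* (Q ℚ.* (Q ℚ.* 1ℚ)) ≡ (u ℚ.* Q) ℚ.* ((u ℚ.* Q) ℚ.* ((u ℚ.* Q) ℚ.* 1ℚ))
    cube = solve 2 (λ u Q → u :* (u :* (u :* con 1ℚ)) :* Q :* (Q :* (Q :* con 1ℚ))
                          := (u :* Q) :* ((u :* Q) :* ((u :* Q) :* con 1ℚ))) refl
    tQ³≡M³ : t ℚ.* Q ℚ.* (Q ℚ.* (Q ℚ.* 1ℚ)) ≡ toℚ M ^ᵠ 3
    tQ³≡M³ = trans (cube u Q) (cong (_^ᵠ 3) ([m/n]*n≡m M q))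

  7/8M³≤∑∑Δ² : toℚ M ^ᵠ 3 ℚ.< 1/4 ^ᵠ 3 ℚ.* toℚ (q ^ 2) → 7/8 ℚ.* toℚ (M ^ 3) ℚ.≤ ∑∑Δ²
  7/8M³≤∑∑Δ² M-small = m≤X+k*m⇒7/8*m≤X (0≤toℚ (M ^ 3)) k≤1/8 (begin
    toℚ (M ^ 3)
      ≤⟨ toℚ-mono-≤ M^3≤∑∑A² ⟩
    toℚ (∑[ c₁ ∈ C ] ∑[ c₂ ∈ C ] a c₁ c₂ * a c₁ c₂)
      ≤⟨ ∑∑A²≤∑∑Δ²+2t∑∑AA₀ ⟩
    ∑∑Δ² ℚ.+ (t ℚ.+ t) ℚ.* toℚ (∑[ c₁ ∈ C ] ∑[ c₂ ∈ C ] a c₁ c₂ * b c₁ c₂)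
      ≤⟨ ℚ.+-monoʳ-≤ ∑∑Δ² (ℚ.*-monoˡ-≤-nonNeg (t ℚ.+ t) {{ℚ.nonNegative (ℚ.+-mono-≤ 0≤t 0≤t)}}
                          (toℚ-mono-≤ ∑∑AA₀≤M^3*q*4)) ⟩
    ∑∑Δ² ℚ.+ (t ℚ.+ t) ℚ.* toℚ (M ^ 3 * (q * 4))
      ≡⟨ cong (λ s → ∑∑Δ² ℚ.+ (t ℚ.+ t) ℚ.* s) (trans (toℚ-* (M ^ 3) _) (cong (toℚ (M ^ 3) ℚ.*_) (toℚ-* q 4))) ⟩
    ∑∑Δ² ℚ.+ (t ℚ.+ t) ℚ.* (toℚ (M ^ 3) ℚ.* (Q ℚ.* toℚ 4))
      ≡⟨ cong (λ s → ∑∑Δ² ℚ.+ s) (regroup t (toℚ (M ^ 3)) Q) ⟩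
    ∑∑Δ² ℚ.+ (t ℚ.+ t) ℚ.* (Q ℚ.* toℚ 4) ℚ.* toℚ (M ^ 3) ∎)
    where
    open ℚ.≤-Reasoning
    regroup : ∀ t m Q → (t ℚ.+ t) ℚ.* (m ℚ.* (Q ℚ.* toℚ 4)) ≡ (t ℚ.+ t) ℚ.* (Q ℚ.* toℚ 4) ℚ.* m
    regroup = solve 3 (λ t m Q → (t :+ t) :* (m :* (Q :* con (toℚ 4))) := (t :+ t) :* (Q :* con (toℚ 4)) :* m) refl
    k≤1/8 : (t ℚ.+ t) ℚ.* (Q ℚ.* toℚ 4) ℚ.≤ 1/8
    k≤1/8 = begin
      (t ℚ.+ t) ℚ.* (Q ℚ.* toℚ 4)  ≡⟨ solve 2 (λ t Q → (t :+ t) :* (Q :* con (toℚ 4)) := t :* Q :* con (toℚ 8)) refl t Q ⟩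
      t ℚ.* Q ℚ.* toℚ 8            ≤⟨ ℚ.*-monoʳ-≤-nonNeg (toℚ 8) (ℚ.<⇒≤ (t*q<[1/4]³ M-small)) ⟩
      1/4 ^ᵠ 3 ℚ.* toℚ 8           ≡⟨⟩
      1/8                          ∎

mainTheorem6 : Σ ℚ λ λ′ → Σ ℚ λ c → Positive λ′ × Positive c ×
    ((q : ℕ) → (qp : Prime q) → ¬ (2 ∣ q) → (M : ℕ) → 1 ℕ.≤ M →
      toℚ M ^ᵠ 3 ℚ.< (λ′ ^ᵠ 3) ℚ.* toℚ (q ℕ.^ 2) →
      c ℚ.* toℚ (M ℕ.^ 3) ℚ.≤
        sumℚ (λ c₁ → sumℚ (λ c₂ → Δ M q {{prime⇒nonZero qp}} (+ c₁) (+ c₂) ^ᵠ 2) (range1 q)) (range1 q))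
mainTheorem6 = 1/4 , 7/8 , _ , _ , λ q q-prime _ M _ →
  7/8M³≤∑∑Δ² q {{prime⇒nonZero q-prime}} q-prime M
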